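{- Let $n\ge1$ and $\alpha\in\mathscr J_n$. Then $\alpha$ is an idempotent if and only if its interface graph $\Gamma(\alpha)$ has no path component of odd length.
   Context: Upper vertices $[n]=\{1,\dots,n\}$, lower vertices $[n]'=\{1',\dots,n'\}$. Partitions of $[n]\cup[n]'$ are multiplied by identifying each lower vertex $i'$ of the first factor with upper vertex $i$ of the second, taking connected components, and restricting to the outer rows (components entirely in the middle row are discarded). A partition is planar if, placing $i$ at $(i,1)$ and $i'$ at $(i,0)$, its blocks can be drawn as pairwise disjoint connected sets in $[1,n]\times[0,1]$. The Jones (Temperley–Lieb) monoid $\mathscr J_n$ consists of planar partitions all of whose blocks have size exactly 2. The interface graph $\Gamma(\alpha)$ has vertex set $[n]$, an upper edge $\{a,b\}$ for each block $\{a,b\}\subseteq[n]$ and a lower edge $\{a,b\}$ for each block $\{a',b'\}\subseteq[n]'$ of $\alpha$ (upper and lower edges distinguished, so a double edge is a cycle of length 2); its components are cycles and paths (a single vertex being a path of length 0), and the length of a path is its number of edges. -}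

module Defs where

open import Data.Nat using (ℕ; zero; suc; _+_; _*_; _∸_; _<_; _≤_)
open import Data.Fin using (Fin; toℕ; inject₁) renaming (suc to fsuc)
open import Data.Sum using (_⊎_; inj₁; inj₂)
open import Data.Product using (_×_; _,_; Σ; ∃; ∃-syntax)
open import Data.Bool using (Bool; true; false)
open import Function using (Injective)
open import Relation.Nullary using (¬_)
open import Relation.Binary.PropositionalEquality using (_≡_; _≢_)
open import Relation.Binary.Construct.Closure.ReflexiveTransitive using (Star)

-- Points of [n] ∪ [n]' : inj₁ i is the upper vertex i, inj₂ i the lower vertex i'.
Pt : ℕ → Set
Pt n = Fin n ⊎ Fin n

-- Position of a point on the boundary of the rectangle [1,n]×[0,1], read
-- cyclically: 1,2,…,n along the top, then n',…,1' along the bottom.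
pos : ∀ {n} → Pt n → ℕ
pos (inj₁ i) = toℕ i
pos {n} (inj₂ i) = (n + n) ∸ suc (toℕ i)

-- Elements of the Jones monoid: a partition of [n] ∪ [n]' into blocks of size
-- exactly two, encoded by the fixed-point-free involution x ↦ partner of x,
-- which is planar (no two blocks cross in the boundary order).
record Jones (n : ℕ) : Set where
  field
    m      : Pt n → Pt n
    invol  : ∀ x → m (m x) ≡ x
    nofix  : ∀ x → m x ≢ x
    planar : ∀ x y → ¬ (pos x < pos y × pos y < pos (m x) × pos (m x) < pos (m y))
open Jones public

SameBlock : ∀ {n} → Jones n → Pt n → Pt n → Set
SameBlock α x y = x ≡ y ⊎ m α x ≡ y

-- Product: the graph on three rows (top, middle, bottom).
data Row : Set where top mid bot : Row

V3 : ℕ → Set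
V3 n = Row × Fin n

embedUp : ∀ {n} → Pt n → V3 n
embedUp (inj₁ i) = top , i
embedUp (inj₂ i) = mid , i

embedDown : ∀ {n} → Pt n → V3 n
embedDown (inj₁ i) = mid , i
embedDown (inj₂ i) = bot , i

outer : ∀ {n} → Pt n → V3 n
outer (inj₁ i) = top , i
outer (inj₂ i) = bot , i

GlueEdge : ∀ {n} → Jones n → Jones n → V3 n → V3 n → Set
GlueEdge {n} α β u v =
  (Σ (Pt n) λ x → Σ (Pt n) λ y → SameBlock α x y × embedUp x ≡ u × embedUp y ≡ v)
  ⊎ (Σ (Pt n) λ x → Σ (Pt n) λ y → SameBlock β x y × embedDown x ≡ u × embedDown y ≡ v)

ProdBlock : ∀ {n} → Jones n → Jones n → Pt n → Pt n → Set
ProdBlock α β x y = Star (GlueEdge α β) (outer x) (outer y)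

IsIdempotent : ∀ {n} → Jones n → Set
IsIdempotent {n} α = ∀ (x y : Pt n) → (ProdBlock α α x y → SameBlock α x y)
                                   × (SameBlock α x y → ProdBlock α α x y)

-- Interface graph Γ(α) on vertex set [n].  Side true = upper, false = lower.
sidePt : ∀ {n} → Bool → Fin n → Pt n
sidePt true  a = inj₁ a
sidePt false a = inj₂ a

record Edge {n : ℕ} (α : Jones n) : Set where
  constructor edge
  field
    side : Bool
    src  : Fin n
    tgt  : Fin n
    isBlock : m α (sidePt side src) ≡ sidePt side tgt
open Edge public

SameEdge : ∀ {n} {α : Jones n} → Edge α → Edge α → Set
SameEdge e f = side e ≡ side f × ((src e ≡ src f × tgt e ≡ tgt f) ⊎ (src e ≡ tgt f × tgt e ≡ src f))

Joins : ∀ {n} {α : Jones n} → Edge α → Fin n → Fin n → Set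
Joins e a b = (src e ≡ a × tgt e ≡ b) ⊎ (src e ≡ b × tgt e ≡ a)

Incident : ∀ {n} {α : Jones n} → Edge α → Fin n → Set
Incident e a = src e ≡ a ⊎ tgt e ≡ a

-- Γ(α) has a connected component which is a path of length L:
-- distinct vertices v₀,…,v_L, edges e₁,…,e_L with eᵢ joining v_{i-1}, vᵢ,
-- and every edge incident to some vⱼ is one of the eᵢ (so this is a whole
-- component and its edge set is exactly that of the path).
PathComponent : ∀ {n} → Jones n → ℕ → Set
PathComponent {n} α L =
  Σ (Fin (suc L) → Fin n) λ v → Injective _≡_ _≡_ v ×
  Σ (Fin L → Edge α) λ e →
    (∀ i → Joins (e i) (v (inject₁ i)) (v (fsuc i))) ×
    (∀ (f : Edge α) (j : Fin (suc L)) → Incident f (v j) → ∃[ i ] SameEdge f (e i))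

Odd : ℕ → Set
Odd L = ∃[ k ] L ≡ suc (2 * k)

module Submission where

-- Every vertex of Γ(α) has at most one upper and one lower edge; it is "free" on a side
-- when its point on that side lies in a transversal block.  The path components of Γ(α) are
-- traced by alternating walks, which start at a vertex free on one side, follow edges on
-- alternating sides, and stop at a vertex free on the next side; so the theorem is about the
-- parity of such walks.
--
-- (⇒) The ends of an odd walk are free on the same side, so in αα the other points of their
--     two transversal blocks are joined through the middle row, although α separates them.
-- (⇐) If all walks are even, the component of a lower-free vertex c is a path from c to an
--     upper-free vertex.  A parity count (a discrete Jordan curve argument resting on
--     planarity) shows that c ↦ this end is increasing, as is c ↦ a for the transversal
--     blocks {a, c′} of α.  Two increasing bijections between the same finite sets agree, so
--     each transversal {a, c′} runs in αα through the component of c, and αα = α.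

open import Defs
open import Data.Nat using (ℕ; zero; suc; _+_; _*_; _≤_; _<_; z≤n; s≤s; parity)
open import Data.Nat.Properties
  using ( ≤-refl; ≤-trans; ≤-reflexive; <⇒≤; <-trans; n<1+n; n≤1+n; ≤-pred; ≮⇒≥; m≤n⇒m<n∨m≡n
        ; +-suc; +-identityʳ; suc-injective; +-commutativeSemigroup; m+n∸n≡m; m≤n+m
        ; ∸-monoʳ-≤; ∸-monoʳ-< )
  renaming (<-cmp to <-cmpℕ; <-irrefl to <-irreflℕ)
open import Data.Parity.Base using (Parity; 0ℙ; 1ℙ) renaming (_+_ to _ℙ+_)
import Data.Parity.Properties as ℙ
open import Algebra.Properties.CommutativeSemigroup +-commutativeSemigroup
  using () renaming (interchange to +-interchange)
open import Data.Fin using (Fin; toℕ; inject₁; fromℕ<) renaming (zero to fzero; suc to fsuc; _<_ to _<ᶠ_)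
open import Data.Fin.Properties
  using (_≟_; _<?_; <-cmp; <-irrefl; <-asym; toℕ-injective; toℕ<n; toℕ-inject₁; toℕ-fromℕ<; any?; pigeonhole)
import Data.Fin.Properties as Fin
open import Data.Fin.Induction using (<-wellFounded)
open import Data.Bool using (Bool; true; false; not)
open import Data.Bool.Properties using (not-involutive; not-¬; ¬-not) renaming (_≟_ to _≟ᵇ_)
open import Data.Product using (Σ; ∃; ∃-syntax; _×_; _,_; proj₁; proj₂; map₁)
open import Data.Sum using (_⊎_; inj₁; inj₂) renaming (map to ⊎-map)
open import Data.Empty using (⊥; ⊥-elim)
open import Function using (_∘_; case_of_)
open import Induction.WellFounded using (Acc; acc)
open import Relation.Binary using (Rel; Tri; tri<; tri≈; tri>)
open import Relation.Binary.PropositionalEquality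
  using (_≡_; _≢_; refl; sym; trans; cong; cong₂; subst; subst₂; module ≡-Reasoning)
open import Relation.Binary.Construct.Closure.ReflexiveTransitive
  using (Star; ε; _◅_; _◅◅_; reverse; gmap)
open import Relation.Nullary using (¬_; Dec; yes; no)
open import Relation.Nullary.Decidable using (_×-dec_; ¬?)
open import Relation.Unary using (Pred; Decidable)
open import Level using (0ℓ)

ind : ∀ {A : Set} → Dec A → ℕ
ind (yes _) = 1
ind (no  _) = 0

ind-yes : ∀ {A : Set} → A → (a : Dec A) → ind a ≡ 1
ind-yes x (yes _) = refl
ind-yes x (no ¬x) = ⊥-elim (¬x x)

ind-holds : ∀ {A : Set} (a : Dec A) → parity (ind a) ≡ 1ℙ → A
ind-holds (yes x) _ = x
ind-holds (no _)  ()

ind-cong : ∀ {A B : Set} → (A → B) → (B → A) → (a : Dec A) (b : Dec B) → ind a ≡ ind b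
ind-cong f g (yes _) (yes _) = refl
ind-cong f g (yes a) (no ¬b) = ⊥-elim (¬b (f a))
ind-cong f g (no ¬a) (yes b) = ⊥-elim (¬a (g b))
ind-cong f g (no _)  (no _)  = refl

ind-split : ∀ {A B : Set} (a : Dec A) (b : Dec B) → ind a ≡ ind (a ×-dec b) + ind (a ×-dec ¬? b)
ind-split (yes _) (yes _) = refl
ind-split (yes _) (no  _) = refl
ind-split (no  _) _       = refl

count : ∀ {k} {P : Pred (Fin k) 0ℓ} → Decidable P → ℕ
count {zero}  P? = 0
count {suc k} P? = ind (P? fzero) + count (P? ∘ fsuc)

count-cong : ∀ {k} {P Q : Pred (Fin k) 0ℓ} (P? : Decidable P) (Q? : Decidable Q) →
             (∀ {x} → P x → Q x) → (∀ {x} → Q x → P x) → count P? ≡ count Q?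
count-cong {zero}  P? Q? f g = refl
count-cong {suc k} P? Q? f g =
  cong₂ _+_ (ind-cong f g (P? fzero) (Q? fzero)) (count-cong (P? ∘ fsuc) (Q? ∘ fsuc) f g)

count-split : ∀ {k} {P Q : Pred (Fin k) 0ℓ} (P? : Decidable P) (Q? : Decidable Q) →
              count P? ≡ count (λ x → P? x ×-dec Q? x) + count (λ x → P? x ×-dec ¬? (Q? x))
count-split {zero}  P? Q? = refl
count-split {suc k} P? Q? =
  trans (cong₂ _+_ (ind-split (P? fzero) (Q? fzero)) (count-split (P? ∘ fsuc) (Q? ∘ fsuc)))
        (+-interchange (ind (P? fzero ×-dec Q? fzero)) (ind (P? fzero ×-dec ¬? (Q? fzero))) _ _)

count-empty : ∀ {k} {P : Pred (Fin k) 0ℓ} (P? : Decidable P) → (∀ {x} → ¬ P x) → count P? ≡ 0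
count-empty {zero}  P? none = refl
count-empty {suc k} P? none with P? fzero
... | yes p = ⊥-elim (none p)
... | no  _ = count-empty (P? ∘ fsuc) none

count-witness : ∀ {k} {P : Pred (Fin k) 0ℓ} (P? : Decidable P) {N} → count P? ≡ suc N → ∃ P
count-witness {suc k} P? eq with P? fzero
... | yes p = fzero , p
... | no  _ = let (x , p) = count-witness (P? ∘ fsuc) eq in fsuc x , p

count-remove : ∀ {k} {P : Pred (Fin k) 0ℓ} (P? : Decidable P) {x} → P x →
               count P? ≡ suc (count (λ y → P? y ×-dec ¬? (y ≟ x)))
count-remove {suc k} P? {fzero} p with P? fzero
... | no ¬p = ⊥-elim (¬p p)
... | yes _ = cong suc (count-cong (P? ∘ fsuc) _ (λ q → q , λ ()) proj₁)
count-remove {suc k} P? {fsuc x} p =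
  trans (cong₂ _+_ (ind-cong (λ q → q , λ ()) proj₁ (P? fzero) (P? fzero ×-dec ¬? (fzero ≟ fsuc x)))
                   (trans (count-remove (P? ∘ fsuc) p)
                          (cong suc (count-cong (λ y → P? (fsuc y) ×-dec ¬? (y ≟ x))
                                                (λ y → P? (fsuc y) ×-dec ¬? (fsuc y ≟ fsuc x))
                                                (λ (q , ne) → q , ne ∘ Fin.suc-injective)
                                                (λ (q , ne) → q , ne ∘ cong fsuc)))))
        (+-suc _ _)

count-at-most-one : ∀ {k} {P : Pred (Fin k) 0ℓ} (P? : Decidable P) {f} →
                    (∀ {y} → P y → y ≡ f) → count P? ≡ ind (P? f)
count-at-most-one P? {f} only-f with P? f
... | yes p = trans (count-remove P? p)
                    (cong suc (count-empty (λ y → P? y ×-dec ¬? (y ≟ f)) λ (q , y≢f) → y≢f (only-f q)))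
... | no ¬p = count-empty P? λ q → ¬p (subst _ (only-f q) q)

record Matching {k} (E : Rel (Fin k) 0ℓ) : Set where
  field
    symmetric  : ∀ {x y} → E x y → E y x
    irreflexive : ∀ {x} → ¬ E x x
    functional : ∀ {x y z} → E x y → E x z → y ≡ z

module _ {k} {E : Rel (Fin k) 0ℓ} (M : Matching E) where
  open Matching M

  matched-even : ∀ {P : Pred (Fin k) 0ℓ} (P? : Decidable P) →
                 (∀ {x} → P x → ∃[ y ] E x y × P y) → parity (count P?) ≡ 0ℙ
  matched-even P? cover = go (count P?) P? cover refl
    where
    go : ∀ N {P : Pred (Fin k) 0ℓ} (P? : Decidable P) →
         (∀ {x} → P x → ∃[ y ] E x y × P y) → count P? ≡ N → parity N ≡ 0ℙ
    go zero          P? cover eq = refl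
    go (suc N) {P} P? cover eq with count-witness P? eq
    ... | x , px with cover px
    ...   | y , exy , py = finish N (trans (sym eq) count-pair)
      where
      P₁? : Decidable (λ z → P z × ¬ z ≡ x)
      P₁? z = P? z ×-dec ¬? (z ≟ x)
      P₂? : Decidable (λ z → (P z × ¬ z ≡ x) × ¬ z ≡ y)
      P₂? z = P₁? z ×-dec ¬? (z ≟ y)
      count-pair : count P? ≡ suc (suc (count P₂?))
      count-pair = trans (count-remove P? px)
                         (cong suc (count-remove P₁? (py , λ y≡x → irreflexive (subst (E x) y≡x exy))))
      cover₂ : ∀ {z} → (P z × ¬ z ≡ x) × ¬ z ≡ y → ∃[ w ] E z w × ((P w × ¬ w ≡ x) × ¬ w ≡ y)
      cover₂ ((pz , z≢x) , z≢y) with cover pz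
      ... | w , ezw , pw =
        w , ezw , (pw , λ { refl → z≢y (functional (symmetric ezw) exy) })
                , λ { refl → z≢x (functional (symmetric ezw) (symmetric exy)) }
      finish : ∀ N → suc N ≡ suc (suc (count P₂?)) → parity (suc N) ≡ 0ℙ
      finish zero ()
      finish (suc N) eq₂ = go N P₂? cover₂ (sym (suc-injective (suc-injective eq₂)))

  parity-matched-part : ∀ {P Q : Pred (Fin k) 0ℓ} (P? : Decidable P) (Q? : Decidable Q) →
                        (∀ {x} → Q x → P x) →
                        (∀ {x} → P x → ¬ Q x → ∃[ y ] E x y × P y × ¬ Q y) →
                        parity (count P?) ≡ parity (count Q?)
  parity-matched-part {P} {Q} P? Q? Q⊆P cover = begin
    parity (count P?)
      ≡⟨ cong parity (count-split P? Q?) ⟩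
    parity (count inside + count outside)
      ≡⟨ ℙ.+-homo-+ (count inside) (count outside) ⟩
    parity (count inside) ℙ+ parity (count outside)
      ≡⟨ cong₂ (λ a b → parity a ℙ+ b) (count-cong inside Q? proj₂ (λ q → Q⊆P q , q))
                     (matched-even outside (λ (p , ¬q) → cover p ¬q)) ⟩
    parity (count Q?) ℙ+ 0ℙ
      ≡⟨ ℙ.+-identityʳ _ ⟩
    parity (count Q?) ∎
    where
    open ≡-Reasoning
    inside : Decidable (λ x → P x × Q x)
    inside x = P? x ×-dec Q? x
    outside : Decidable (λ x → P x × ¬ Q x)
    outside x = P? x ×-dec ¬? (Q? x)

record IncreasingBijection {n} (A B : Pred (Fin n) 0ℓ) (R : Rel (Fin n) 0ℓ) : Set where
  field
    domain     : ∀ {a b} → R a b → A a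
    codomain   : ∀ {a b} → R a b → B b
    total      : ∀ {a} → A a → ∃ (R a)
    onto       : ∀ {b} → B b → ∃ λ a → R a b
    functional : ∀ {a b b′} → R a b → R a b′ → b ≡ b′
    increasing : ∀ {a a′ b b′} → R a b → R a′ b′ → a <ᶠ a′ → b <ᶠ b′

module _ {n} {A B : Pred (Fin n) 0ℓ} where
  open IncreasingBijection

  -- If two increasing bijections agree below a, the first cannot take a smaller value at a:
  -- that value is hit by the second one at some a′, and each position of a′ relative to a
  -- contradicts monotonicity or agreement.
  no-dip : ∀ {R S} → IncreasingBijection A B R → IncreasingBijection A B S →
           ∀ {a} → (∀ {a′} → a′ <ᶠ a → ∀ {b c} → R a′ b → S a′ c → b ≡ c) →
           ∀ {b c} → R a b → S a c → ¬ b <ᶠ c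
  no-dip IR IS {a} agree {b} rab sac b<c with onto IS (codomain IR rab)
  ... | a′ , sa′b with <-cmp a′ a
  ... | tri< a′<a _ _ = let (b′ , ra′b′) = total IR (domain IS sa′b) in
                        <-irrefl refl (subst (_<ᶠ b) (agree a′<a ra′b′ sa′b) (increasing IR ra′b′ rab a′<a))
  ... | tri≈ _ refl _ = <-irrefl (functional IS sa′b sac) b<c
  ... | tri> _ _ a<a′ = <-asym b<c (increasing IS sac sa′b a<a′)

  increasing-bijections-agree : ∀ {R S} → IncreasingBijection A B R → IncreasingBijection A B S →
                                ∀ {a b c} → R a b → S a c → b ≡ c
  increasing-bijections-agree {R} {S} IR IS {a} = go a (<-wellFounded a)
    where
    go : ∀ a → Acc _<ᶠ_ a → ∀ {b c} → R a b → S a c → b ≡ c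
    go a (acc below) {b} {c} rab sac with <-cmp b c
    ... | tri≈ _ b≡c _ = b≡c
    ... | tri< b<c _ _ = ⊥-elim (no-dip IR IS (λ a′<a → go _ (below a′<a)) rab sac b<c)
    ... | tri> _ _ c<b = ⊥-elim (no-dip IS IR (λ a′<a s r → sym (go _ (below a′<a) r s)) sac rab c<b)

star-preserves : ∀ {I : Set} {T : Rel I 0ℓ} (Q : Pred I 0ℓ) →
                 (∀ {u v} → T u v → Q u → Q v) → ∀ {u v} → Star T u v → Q u → Q v
star-preserves Q step ε        q = q
star-preserves Q step (t ◅ ts) q = star-preserves Q step ts (step t q)

sideAt : Bool → ℕ → Bool
sideAt s zero    = s
sideAt s (suc k) = not (sideAt s k)

sideAt-even : ∀ {s} k → parity k ≡ 0ℙ → sideAt s k ≡ s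
sideAt-even zero          _ = refl
sideAt-even (suc zero)    ()
sideAt-even (suc (suc k)) p = trans (not-involutive _) (sideAt-even k p)

sideAt-odd : ∀ {s} k → parity k ≡ 1ℙ → sideAt s k ≡ not s
sideAt-odd zero          ()
sideAt-odd (suc zero)    _ = refl
sideAt-odd (suc (suc k)) p = trans (not-involutive _) (sideAt-odd k p)

parity-odd : ∀ {L} → Odd L → parity L ≡ 1ℙ
parity-odd (k , refl) = trans (ℙ.+-homo-+ 1 (2 * k)) (cong (1ℙ ℙ+_) (ℙ.*-homo-* 2 k))

odd-parity : ∀ L → parity L ≡ 1ℙ → Odd L
odd-parity zero          ()
odd-parity (suc zero)    _ = 0 , refl
odd-parity (suc (suc L)) p with odd-parity L p
... | k , refl = suc k , cong (suc ∘ suc) (sym (+-suc k (k + 0)))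

-- The element j of Fin (suc L) when j ≤ L (larger numbers are sent to 0).
clamp : ∀ {L} → ℕ → Fin (suc L)
clamp {L}     zero    = fzero
clamp {zero}  (suc j) = fzero
clamp {suc L} (suc j) = fsuc (clamp j)

toℕ-clamp : ∀ {L} j → j ≤ L → toℕ (clamp {L} j) ≡ j
toℕ-clamp {L}     zero    _         = refl
toℕ-clamp {suc L} (suc j) (s≤s j≤L) = cong suc (toℕ-clamp j j≤L)

clamp-toℕ : ∀ {L} (i : Fin (suc L)) → clamp (toℕ i) ≡ i
clamp-toℕ i = toℕ-injective (toℕ-clamp (toℕ i) (≤-pred (toℕ<n i)))

right-of : ∀ {n} {y w : Fin n} → w ≢ y → ¬ w <ᶠ y → y <ᶠ w
right-of w≢y w≮y = Fin.≤∧≢⇒< (≮⇒≥ w≮y) (w≢y ∘ sym)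

upper<lower : ∀ {n} (i j : Fin n) → pos {n} (inj₁ i) < pos {n} (inj₂ j)
upper<lower {n} i j =
  ≤-trans (toℕ<n i) (≤-trans (≤-reflexive (sym (m+n∸n≡m n n))) (∸-monoʳ-≤ (n + n) (toℕ<n j)))

lower-reversed : ∀ {n} {i j : Fin n} → i <ᶠ j → pos {n} (inj₂ j) < pos {n} (inj₂ i)
lower-reversed {n} {i} {j} i<j = ∸-monoʳ-< (s≤s i<j) (≤-trans (toℕ<n j) (m≤n+m n n))

sidePt-injective : ∀ {n} s {x y : Fin n} → sidePt s x ≡ sidePt s y → x ≡ y
sidePt-injective true  refl = refl
sidePt-injective false refl = refl

module Local {n : ℕ} (α : Jones n) where

  Arc : Bool → Fin n → Fin n → Set
  Arc s x y = m α (sidePt s x) ≡ sidePt s y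

  -- The s-point of x lies in a transversal block, whose other point is the opposite point of y.
  Cross : Bool → Fin n → Fin n → Set
  Cross s x y = m α (sidePt s x) ≡ sidePt (not s) y

  Free : Bool → Fin n → Set
  Free s x = ∃ (Cross s x)

  data Partner (s : Bool) (x : Fin n) : Set where
    arc   : ∀ {y} → Arc s x y → Partner s x
    cross : ∀ {y} → Cross s x y → Partner s x

  partner : ∀ s x → Partner s x
  partner true x with m α (inj₁ x) in eq
  ... | inj₁ _ = arc eq
  ... | inj₂ _ = cross eq
  partner false x with m α (inj₂ x) in eq
  ... | inj₁ _ = cross eq
  ... | inj₂ _ = arc eq

  m-injective : ∀ {p q} → m α p ≡ m α q → p ≡ q
  m-injective {p} {q} e = trans (sym (invol α p)) (trans (cong (m α) e) (invol α q))

  arc-symmetric : ∀ {s x y} → Arc s x y → Arc s y x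
  arc-symmetric a = trans (cong (m α) (sym a)) (invol α _)

  arc-matching : ∀ {s} → Matching (Arc s)
  arc-matching {s} = record
    { symmetric   = arc-symmetric
    ; irreflexive = nofix α _
    ; functional  = λ a b → sidePt-injective s (trans (sym a) b)
    }

  arc-not-free : ∀ {s x y} → Arc s x y → ¬ Free s x
  arc-not-free {true}  a (_ , c) with trans (sym a) c
  ... | ()
  arc-not-free {false} a (_ , c) with trans (sym a) c
  ... | ()

  cross-symmetric : ∀ {s x y} → Cross s x y → Cross (not s) y x
  cross-symmetric {true}  c = trans (cong (m α) (sym c)) (invol α _)
  cross-symmetric {false} c = trans (cong (m α) (sym c)) (invol α _)

  no-crossing : ∀ {p q p̄ q̄} → m α p ≡ p̄ → m α q ≡ q̄ →
                pos p < pos q → pos q < pos p̄ → pos p̄ < pos q̄ → ⊥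
  no-crossing refl refl p<q q<p̄ p̄<q̄ = planar α _ _ (p<q , q<p̄ , p̄<q̄)

  arcs-noncrossing : ∀ {s p q r t} → Arc s p r → Arc s q t → p <ᶠ q → q <ᶠ r → r <ᶠ t → ⊥
  arcs-noncrossing {true}  a b p<q q<r r<t = no-crossing a b p<q q<r r<t
  arcs-noncrossing {false} a b p<q q<r r<t =
    no-crossing (arc-symmetric b) (arc-symmetric a)
                (lower-reversed r<t) (lower-reversed q<r) (lower-reversed p<q)

  free-not-covered : ∀ {s y z f} → Arc s y z → Free s f → y <ᶠ f → f <ᶠ z → ⊥
  free-not-covered {true}  {z = z} a (g , c) y<f f<z = no-crossing a c y<f f<z (upper<lower z g)
  free-not-covered {false} {z = z} a (g , c) y<f f<z =
    no-crossing (cross-symmetric c) (arc-symmetric a)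
                (upper<lower g z) (lower-reversed f<z) (lower-reversed y<f)

  transversals-increasing : ∀ {c c′ a a′} → Cross false c a → Cross false c′ a′ → c <ᶠ c′ → a <ᶠ a′
  transversals-increasing {c} {c′} {a} {a′} t t′ c<c′ with <-cmp a a′
  ... | tri< a<a′ _ _ = a<a′
  ... | tri≈ _ refl _ = ⊥-elim (<-irrefl (sidePt-injective false (m-injective (trans t (sym t′)))) c<c′)
  ... | tri> _ _ a′<a =
    ⊥-elim (no-crossing (cross-symmetric t′) (cross-symmetric t)
                        a′<a (upper<lower a c′) (lower-reversed c<c′))

module Walks {n : ℕ} (α : Jones n) where
  open Local α
  open Matching using (functional; irreflexive)

  Adjacent : Rel (Fin n) 0ℓ
  Adjacent x y = ∃ λ s → Arc s x y

  Reach : Rel (Fin n) 0ℓ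
  Reach = Star Adjacent

  reach-symmetric : ∀ {x y} → Reach x y → Reach y x
  reach-symmetric = reverse (λ (s , a) → s , arc-symmetric a)

  reach-step : ∀ {s x y z} → Reach x y → Arc s y z → Reach x z
  reach-step r a = r ◅◅ ((_ , a) ◅ ε)

  AltArcs : Bool → (ℕ → Fin n) → ℕ → Set
  AltArcs s w J = ∀ k → k < J → Arc (sideAt s k) (w k) (w (suc k))

  -- An alternating sequence that starts at a vertex free on the side opposite to its first
  -- edge never revisits a vertex: a revisited vertex would carry a third edge, or an edge on
  -- its free side.
  alternating-distinct : ∀ {s w J} → Free (not s) (w 0) → AltArcs s w J →
                         ∀ {i j} → i < j → j ≤ J → w i ≢ w j
  alternating-distinct {s} {w} {J} free₀ steps = go
    where
    go : ∀ {i j} → i < j → j ≤ J → w i ≢ w j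
    go {i} {suc j} i<sj sj≤J wi≡wsj with m≤n⇒m<n∨m≡n (≤-pred i<sj)
    ... | inj₂ refl = irreflexive arc-matching (subst (Arc _ (w i)) (sym wi≡wsj) (steps i sj≤J))
    ... | inj₁ i<j  = revisit i i<j (subst (λ x → Arc (sideAt s j) x (w j)) (sym wi≡wsj)
                                           (arc-symmetric (steps j sj≤J)))
      where
      j≤J : j ≤ J
      j≤J = <⇒≤ sj≤J
      -- the edge from w i to w j is the edge w i → w (suc i) of the sequence
      forward : ∀ i → i < j → sideAt s j ≡ sideAt s i → Arc (sideAt s j) (w i) (w j) → ⊥
      forward i i<j σ≡ a with m≤n⇒m<n∨m≡n i<j
      ... | inj₁ si<j = go si<j j≤J (functional arc-matching (subst (λ σ → Arc σ (w i) _) (sym σ≡)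
                                       (steps i (≤-trans i<j j≤J))) a)
      ... | inj₂ refl = not-¬ refl (sym σ≡)
      -- the edge from w i to w j is the edge w i → w (i - 1) of the sequence
      revisit : ∀ i → i < j → Arc (sideAt s j) (w i) (w j) → ⊥
      revisit zero 0<j a with sideAt s j ≟ᵇ s
      ... | yes σ≡s = forward 0 0<j σ≡s a
      ... | no  σ≢s = arc-not-free (subst (λ σ → Arc σ (w 0) (w j)) (¬-not σ≢s) a) free₀
      revisit (suc i) si<j a with sideAt s j ≟ᵇ sideAt s i
      ... | yes σ≡ = go (<-trans (n<1+n i) si<j) j≤J
                        (functional arc-matching (subst (λ σ → Arc σ (w (suc i)) _) (sym σ≡)
                           (arc-symmetric (steps i (≤-trans (<⇒≤ si<j) j≤J)))) a)
      ... | no  σ≢ = forward (suc i) si<j (¬-not σ≢) a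

  record Walk : Set where
    field
      start      : Bool
      len        : ℕ
      vtx        : ℕ → Fin n
      steps      : AltArcs start vtx len
      first-free : Free (not start) (vtx 0)
      last-free  : Free (sideAt start len) (vtx len)

  -- The neighbour of x along its edge on side s (x itself if there is none).
  follow : Bool → Fin n → Fin n
  follow s x with partner s x
  ... | arc {y} _ = y
  ... | cross _   = x

  follow-arc : ∀ {s x y} → Arc s x y → follow s x ≡ y
  follow-arc {s} {x} a with partner s x
  ... | arc a′  = functional arc-matching a′ a
  ... | cross c = ⊥-elim (arc-not-free a (_ , c))

  iterate : Bool → Fin n → ℕ → Fin n
  iterate s c zero    = c
  iterate s c (suc k) = follow (sideAt s k) (iterate s c k)

  -- From every vertex free on side (not s) starts an alternating walk with first side s.
  -- It stops within n steps, since its vertices are distinct.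
  walk-from : ∀ s c → Free (not s) c → Σ Walk λ W → Walk.start W ≡ s × Walk.vtx W 0 ≡ c
  walk-from s c free = extend n 0 (+-identityʳ n) (λ _ ())
    where
    w : ℕ → Fin n
    w = iterate s c
    extend : ∀ fuel J → fuel + J ≡ n → AltArcs s w J → Σ Walk λ W → Walk.start W ≡ s × Walk.vtx W 0 ≡ c
    extend zero J refl steps with pigeonhole (n<1+n n) (λ (i : Fin (suc n)) → w (toℕ i))
    ... | i , j , i<j , wi≡wj = ⊥-elim (alternating-distinct free steps i<j (≤-pred (toℕ<n j)) wi≡wj)
    extend (suc fuel) J eq steps with partner (sideAt s J) (w J)
    ... | cross c = record { start = s ; len = J ; vtx = w ; steps = steps
                           ; first-free = free ; last-free = _ , c } , refl , refl
    ... | arc a   = extend fuel (suc J) (trans (+-suc fuel J) eq) steps′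
      where
      steps′ : AltArcs s w (suc J)
      steps′ k k<sJ with m≤n⇒m<n∨m≡n (≤-pred k<sJ)
      ... | inj₁ k<J  = steps k k<J
      ... | inj₂ refl = subst (Arc _ (w k)) (sym (follow-arc a)) a

  module WalkProperties (W : Walk) where
    open Walk W

    walk-injective : ∀ {i j} → i ≤ len → j ≤ len → vtx i ≡ vtx j → i ≡ j
    walk-injective {i} {j} i≤len j≤len eq with <-cmpℕ i j
    ... | tri< i<j _ _ = ⊥-elim (alternating-distinct first-free steps i<j j≤len eq)
    ... | tri≈ _ i≡j _ = i≡j
    ... | tri> _ _ j<i = ⊥-elim (alternating-distinct first-free steps j<i i≤len (sym eq))

    data Around (k : ℕ) (s : Bool) : Set where
      forward  : k < len → s ≡ sideAt start k → Around k s
      backward : ∀ {k′} → k ≡ suc k′ → s ≡ sideAt start k′ → Around k s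
      first    : k ≡ 0 → s ≡ not start → Around k s
      last     : k ≡ len → s ≡ sideAt start len → Around k s

    around : ∀ {k} → k ≤ len → ∀ s → Around k s
    around {k} k≤len s with s ≟ᵇ sideAt start k | m≤n⇒m<n∨m≡n k≤len
    ... | yes s≡ | inj₁ k<len = forward k<len s≡
    ... | yes s≡ | inj₂ refl  = last refl s≡
    around {zero}  _ s | no s≢ | _ = first refl (¬-not s≢)
    around {suc k} _ s | no s≢ | _ = backward refl (trans (¬-not s≢) (not-involutive _))

    walk-edge : ∀ {k s y} → k ≤ len → Arc s (vtx k) y →
                (k < len × s ≡ sideAt start k × y ≡ vtx (suc k))
                ⊎ (∃ λ k′ → k ≡ suc k′ × s ≡ sideAt start k′ × y ≡ vtx k′)
    walk-edge {k} {s} k≤len a with around k≤len s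
    ... | forward k<len refl = inj₁ (k<len , refl , functional arc-matching a (steps k k<len))
    ... | backward {k′} refl refl =
      inj₂ (k′ , refl , refl , functional arc-matching a (arc-symmetric (steps k′ k≤len)))
    ... | first refl refl = ⊥-elim (arc-not-free a first-free)
    ... | last  refl refl = ⊥-elim (arc-not-free a last-free)

    walk-free : ∀ {k s} → k ≤ len → Free s (vtx k) →
                (k ≡ 0 × s ≡ not start) ⊎ (k ≡ len × s ≡ sideAt start len)
    walk-free {k} {s} k≤len free with around k≤len s
    ... | forward k<len refl = ⊥-elim (arc-not-free (steps k k<len) free)
    ... | backward {k′} refl refl = ⊥-elim (arc-not-free (arc-symmetric (steps k′ k≤len)) free)
    ... | first k≡0 s≡ = inj₁ (k≡0 , s≡)
    ... | last k≡len s≡ = inj₂ (k≡len , s≡)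

    OnWalk : Pred (Fin n) 0ℓ
    OnWalk x = ∃ λ (k : Fin (suc len)) → vtx (toℕ k) ≡ x

    reach-walk : ∀ {k} → k ≤ len → Reach (vtx 0) (vtx k)
    reach-walk {zero}  _      = ε
    reach-walk {suc k} sk≤len = reach-step (reach-walk (<⇒≤ sk≤len)) (steps k sk≤len)

    walk-closed : ∀ {s x y} → Arc s x y → OnWalk x → OnWalk y
    walk-closed a (k , refl) with walk-edge (≤-pred (toℕ<n k)) a
    ... | inj₁ (k<len , _ , refl) = fromℕ< (s≤s k<len) , cong vtx (toℕ-fromℕ< (s≤s k<len))
    ... | inj₂ (k′ , k≡ , _ , refl) =
      fromℕ< (s≤s k′≤len) , cong vtx (toℕ-fromℕ< (s≤s k′≤len))
      where k′≤len = ≤-trans (n≤1+n k′) (subst (_≤ len) k≡ (≤-pred (toℕ<n k)))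

    reach-on-walk : ∀ {x} → Reach (vtx 0) x → OnWalk x
    reach-on-walk r = star-preserves OnWalk (λ (_ , a) → walk-closed a) r (fzero , refl)

    free-member : ∀ {s x} → Reach (vtx 0) x → Free s x →
                  (x ≡ vtx 0 × s ≡ not start) ⊎ (x ≡ vtx len × s ≡ sideAt start len)
    free-member r free-x with reach-on-walk r
    ... | k , refl = ⊎-map (map₁ (cong vtx)) (map₁ (cong vtx))
                             (walk-free (≤-pred (toℕ<n k)) free-x)

    reach? : Decidable (Reach (vtx 0))
    reach? x with any? (λ k → vtx (toℕ k) ≟ x)
    ... | yes (k , eq) = yes (subst (Reach (vtx 0)) eq (reach-walk (≤-pred (toℕ<n k))))
    ... | no  ¬on      = no (¬on ∘ reach-on-walk)

    walk-component : PathComponent α len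
    walk-component = v , v-injective , e , (λ i → inj₁ (cong vtx (sym (toℕ-inject₁ i)) , refl)) , closed
      where
      v : Fin (suc len) → Fin n
      v j = vtx (toℕ j)
      v-injective : ∀ {i j} → v i ≡ v j → i ≡ j
      v-injective {i} {j} eq = toℕ-injective (walk-injective (≤-pred (toℕ<n i)) (≤-pred (toℕ<n j)) eq)
      e : Fin len → Edge α
      e i = edge (sideAt start (toℕ i)) (vtx (toℕ i)) (vtx (suc (toℕ i))) (steps (toℕ i) (toℕ<n i))
      is-step : ∀ (f : Edge α) k → k < len → side f ≡ sideAt start k →
                Joins f (vtx k) (vtx (suc k)) → ∃[ i ] SameEdge f (e i)
      is-step f k k<len side≡ joins = fromℕ< k<len , same (fromℕ< k<len) (toℕ-fromℕ< k<len)
        where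
        same : ∀ i → toℕ i ≡ k → SameEdge f (e i)
        same i refl = side≡ , joins
      closed : ∀ (f : Edge α) (j : Fin (suc len)) → Incident f (v j) → ∃[ i ] SameEdge f (e i)
      closed f@(edge s a b p) j (inj₁ refl) with walk-edge (≤-pred (toℕ<n j)) p
      ... | inj₁ (j<len , s≡ , b≡) = is-step f (toℕ j) j<len s≡ (inj₁ (refl , b≡))
      ... | inj₂ (k′ , j≡ , s≡ , b≡) =
        is-step f k′ (subst (_≤ len) j≡ (≤-pred (toℕ<n j))) s≡ (inj₂ (cong vtx j≡ , b≡))
      closed f@(edge s a b p) j (inj₂ refl) with walk-edge (≤-pred (toℕ<n j)) (arc-symmetric p)
      ... | inj₁ (j<len , s≡ , a≡) = is-step f (toℕ j) j<len s≡ (inj₂ (a≡ , refl))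
      ... | inj₂ (k′ , j≡ , s≡ , a≡) =
        is-step f k′ (subst (_≤ len) j≡ (≤-pred (toℕ<n j))) s≡ (inj₁ (a≡ , cong vtx j≡))

  joins-arc : ∀ {f : Edge α} {a b} → Joins f a b → Arc (side f) a b
  joins-arc {edge s x y p} (inj₁ (refl , refl)) = p
  joins-arc {edge s x y p} (inj₂ (refl , refl)) = arc-symmetric p

  module ComponentWalk {K : ℕ} (P : PathComponent α (suc K)) where
    L : ℕ
    L = suc K
    v : Fin (suc L) → Fin n
    v = proj₁ P
    v-injective : ∀ {i j} → v i ≡ v j → i ≡ j
    v-injective = proj₁ (proj₂ P)
    e : Fin L → Edge α
    e = proj₁ (proj₂ (proj₂ P))
    joins : ∀ i → Joins (e i) (v (inject₁ i)) (v (fsuc i))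
    joins = proj₁ (proj₂ (proj₂ (proj₂ P)))
    closed : ∀ (f : Edge α) (j : Fin (suc L)) → Incident f (v j) → ∃[ i ] SameEdge f (e i)
    closed = proj₂ (proj₂ (proj₂ (proj₂ P)))

    vN : ℕ → Fin n
    vN j = v (clamp j)
    sN : ℕ → Bool
    sN j = side (e (clamp j))

    vN-injective : ∀ {i j} → i ≤ L → j ≤ L → vN i ≡ vN j → i ≡ j
    vN-injective {i} {j} i≤L j≤L eq =
      trans (sym (toℕ-clamp i i≤L)) (trans (cong toℕ (v-injective eq)) (toℕ-clamp j j≤L))

    step : ∀ j → j < L → Arc (sN j) (vN j) (vN (suc j))
    step j j<L = subst₂ (Arc (sN j)) (cong v (toℕ-injective lower)) (cong v (toℕ-injective upper))
                        (joins-arc {e (clamp j)} (joins (clamp j)))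
      where
      lower : toℕ (inject₁ (clamp {K} j)) ≡ toℕ (clamp {L} j)
      lower = trans (toℕ-inject₁ _) (trans (toℕ-clamp j (≤-pred j<L)) (sym (toℕ-clamp j (<⇒≤ j<L))))
      upper : toℕ (fsuc (clamp {K} j)) ≡ toℕ (clamp {L} (suc j))
      upper = trans (cong suc (toℕ-clamp j (≤-pred j<L))) (sym (toℕ-clamp (suc j) j<L))

    on-edge : ∀ i {x} → (x ≡ src (e i) ⊎ x ≡ tgt (e i)) → x ≡ v (inject₁ i) ⊎ x ≡ v (fsuc i)
    on-edge i x∈ with joins i | x∈
    ... | inj₁ (s≡ , _) | inj₁ x≡ = inj₁ (trans x≡ s≡)
    ... | inj₁ (_ , t≡) | inj₂ x≡ = inj₂ (trans x≡ t≡)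
    ... | inj₂ (s≡ , _) | inj₁ x≡ = inj₂ (trans x≡ s≡)
    ... | inj₂ (_ , t≡) | inj₂ x≡ = inj₁ (trans x≡ t≡)

    edge-at : ∀ {j t y} → j ≤ L → Arc t (vN j) y → ∃ λ i → i < L × t ≡ sN i × (j ≡ i ⊎ j ≡ suc i)
    edge-at {j} {t} {y} j≤L a with closed (edge t (vN j) y a) (clamp j) (inj₁ refl)
    ... | i , t≡ , ends = toℕ i , toℕ<n i , trans t≡ (cong (side ∘ e) (sym (clamp-toℕ i))) , position
      where
      position : j ≡ toℕ i ⊎ j ≡ suc (toℕ i)
      position with on-edge i (⊎-map proj₁ proj₁ ends)
      ... | inj₁ eq = inj₁ (trans (sym (toℕ-clamp j j≤L))
                                  (trans (cong toℕ (v-injective eq)) (toℕ-inject₁ i)))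
      ... | inj₂ eq = inj₂ (trans (sym (toℕ-clamp j j≤L)) (cong toℕ (v-injective eq)))

    -- Consecutive edges lie on opposite sides, since the path does not return to a vertex.
    alternates : ∀ j → suc j < L → sN (suc j) ≡ not (sN j)
    alternates j sj<L with sN (suc j) ≟ᵇ sN j
    ... | no  differ = ¬-not differ
    ... | yes same   = ⊥-elim (<-irreflℕ (sym returns) (<-trans (n<1+n j) (n<1+n (suc j))))
      where
      back-and-forth : vN (suc (suc j)) ≡ vN j
      back-and-forth = functional arc-matching (subst (λ σ → Arc σ _ _) same (step (suc j) sj<L))
                                               (arc-symmetric (step j (<-trans (n<1+n j) sj<L)))
      returns : suc (suc j) ≡ j
      returns = vN-injective sj<L (<⇒≤ (<-trans (n<1+n j) sj<L)) back-and-forth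

    sN-sideAt : ∀ j → j < L → sN j ≡ sideAt (sN 0) j
    sN-sideAt zero    _     = refl
    sN-sideAt (suc j) sj<L = trans (alternates j sj<L) (cong not (sN-sideAt j (<-trans (n<1+n j) sj<L)))

    first-free : Free (not (sN 0)) (vN 0)
    first-free with partner (not (sN 0)) (vN 0)
    ... | cross c = _ , c
    ... | arc a with edge-at z≤n a
    ...   | zero , _ , t≡ , _ = ⊥-elim (not-¬ refl (sym t≡))
    ...   | suc i , _ , _ , inj₁ ()
    ...   | suc i , _ , _ , inj₂ ()

    last-free : Free (sideAt (sN 0) L) (vN L)
    last-free with partner (sideAt (sN 0) L) (vN L)
    ... | cross c = _ , c
    ... | arc a with edge-at ≤-refl a
    ...   | i , i<L , t≡ , inj₁ refl = ⊥-elim (<-irreflℕ refl i<L)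
    ...   | i , i<L , t≡ , inj₂ refl =
      ⊥-elim (not-¬ refl (trans (sym (sN-sideAt K (n<1+n K))) (sym t≡)))

    component-walk : Σ Walk λ W → Walk.len W ≡ L
    component-walk = record
      { start      = sN 0
      ; len        = L
      ; vtx        = vN
      ; steps      = λ k k<L → subst (λ σ → Arc σ _ _) (sN-sideAt k k<L) (step k k<L)
      ; first-free = first-free
      ; last-free  = last-free
      } , refl

  odd-component-walk : ∀ {L} → Odd L → PathComponent α L → Σ Walk λ W → parity (Walk.len W) ≡ 1ℙ
  odd-component-walk odd@(k , refl) P with ComponentWalk.component-walk P
  ... | W , len≡ = W , subst (λ l → parity l ≡ 1ℙ) (sym len≡) (parity-odd odd)

  -- Without odd path components every alternating walk has even length, since each walk is
  -- a path component.
  walks-even : ¬ (∃[ L ] (Odd L × PathComponent α L)) → ∀ W → parity (Walk.len W) ≡ 0ℙ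
  walks-even no-odd W with parity (Walk.len W) in p
  ... | 0ℙ = refl
  ... | 1ℙ = ⊥-elim (no-odd (_ , odd-parity _ p , WalkProperties.walk-component W))

-- The parity argument (a discrete Jordan curve theorem). For a set C of vertices closed
-- under the edges of Γ(α), the parity of the number of members of C to the left of x does
-- not change along edges outside C, and at a free vertex outside C it tells on which side
-- of x the corresponding free vertex of C lies.
module Separation {n : ℕ} (α : Jones n) {C : Pred (Fin n) 0ℓ} (C? : Decidable C)
                  (C-closed : ∀ {s x y} → Local.Arc α s x y → C x → C y) where
  open Local α

  left? : (x : Fin n) → Decidable (λ y → C y × y <ᶠ x)
  left? x y = C? y ×-dec (y <? x)

  leftParity : Fin n → Parity
  leftParity x = parity (count (left? x))

  -- The members of C strictly between the ends of an edge outside C are matched among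
  -- themselves by edges on the same side, since edges on one side do not cross.
  edge-preserves : ∀ {s y z} → Arc s y z → ¬ C y → y <ᶠ z → leftParity y ≡ leftParity z
  edge-preserves {s} {y} {z} a ¬Cy y<z =
    sym (parity-matched-part arc-matching (left? z) (left? y) (λ (c , w<y) → c , <-trans w<y y<z) cover)
    where
    ¬Cz : ¬ C z
    ¬Cz Cz = ¬Cy (C-closed (arc-symmetric a) Cz)
    cover : ∀ {w} → C w × w <ᶠ z → ¬ (C w × w <ᶠ y) →
            ∃[ w̄ ] Arc s w w̄ × (C w̄ × w̄ <ᶠ z) × ¬ (C w̄ × w̄ <ᶠ y)
    cover {w} (Cw , w<z) ¬left = matched (partner s w)
      where
      y<w : y <ᶠ w
      y<w = right-of (λ { refl → ¬Cy Cw }) (λ w<y → ¬left (Cw , w<y))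
      matched : Partner s w → ∃[ w̄ ] Arc s w w̄ × (C w̄ × w̄ <ᶠ z) × ¬ (C w̄ × w̄ <ᶠ y)
      matched (cross c)   = ⊥-elim (free-not-covered a (_ , c) y<w w<z)
      matched (arc {w̄} b) =
        w̄ , b , (Cw̄ , right-of (λ { refl → ¬Cz Cw̄ }) (arcs-noncrossing a b y<w w<z))
          , λ (_ , w̄<y) → arcs-noncrossing (arc-symmetric b) a w̄<y y<w w<z
        where
        Cw̄ : C w̄
        Cw̄ = C-closed b Cw

  -- If x ∉ C is free on side s and f is the only member of C free on side s, the members
  -- of C to the left of x other than f are matched among themselves by edges on side s.
  free-detects : ∀ {s x f} → Free s x → ¬ C x → C f → Free s f →
                 (∀ {y} → C y → Free s y → y ≡ f) → leftParity x ≡ parity (ind (f <? x))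
  free-detects {s} {x} {f} free-x ¬Cx Cf free-f only-f = begin
    leftParity x
      ≡⟨ parity-matched-part arc-matching (left? x) is-f? (λ { (refl , f<x) → Cf , f<x }) cover ⟩
    parity (count is-f?)
      ≡⟨ cong parity (count-at-most-one is-f? proj₁) ⟩
    parity (ind (is-f? f))
      ≡⟨ cong parity (ind-cong proj₂ (refl ,_) (is-f? f) (f <? x)) ⟩
    parity (ind (f <? x)) ∎
    where
    open ≡-Reasoning
    is-f? : Decidable (λ y → y ≡ f × y <ᶠ x)
    is-f? y = (y ≟ f) ×-dec (y <? x)
    cover : ∀ {w} → C w × w <ᶠ x → ¬ (w ≡ f × w <ᶠ x) →
            ∃[ w̄ ] Arc s w w̄ × (C w̄ × w̄ <ᶠ x) × ¬ (w̄ ≡ f × w̄ <ᶠ x)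
    cover {w} (Cw , w<x) ¬f with partner s w
    ... | cross c = ⊥-elim (¬f (only-f Cw (_ , c) , w<x))
    ... | arc {w̄} b =
      w̄ , b , (Cw̄ , right-of (λ { refl → ¬Cx Cw̄ }) (free-not-covered b free-x w<x))
        , λ (w̄≡f , _) → arc-not-free (arc-symmetric b) (subst (Free s) (sym w̄≡f) free-f)
      where
      Cw̄ : C w̄
      Cw̄ = C-closed b Cw

-- When every alternating walk has even length, the component of a lower-free vertex c is an
-- even path from c to an upper-free vertex, and this pairing of lower-free with upper-free
-- vertices is the one given by the transversal blocks of α.
module EvenWalks {n : ℕ} (α : Jones n)
                 (even : ∀ (W : Walks.Walk α) → parity (Walks.Walk.len W) ≡ 0ℙ) where
  open Local α
  open Walks α
  open Matching using (irreflexive)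

  record Strand (c : Fin n) : Set where
    field
      end        : Fin n
      reach?     : Decidable (Reach c)
      reach-end  : Reach c end
      end-free   : Free true end
      lower-only : ∀ {x} → Reach c x → Free false x → x ≡ c
      upper-only : ∀ {x} → Reach c x → Free true x → x ≡ end

  strand : ∀ {c} → Free false c → Strand c
  strand free with walk-from true _ free
  ... | W , refl , refl = record
    { end        = vtx len
    ; reach?     = reach?
    ; reach-end  = reach-walk ≤-refl
    ; end-free   = subst (λ σ → Free σ (vtx len)) last-side last-free
    ; lower-only = λ r free-x → case free-member r free-x of λ
                     { (inj₁ (x≡ , _)) → x≡
                     ; (inj₂ (_ , σ≡)) → ⊥-elim (false≢true (trans σ≡ last-side)) }
    ; upper-only = λ r free-x → case free-member r free-x of λ
                     { (inj₁ (_ , ())) ; (inj₂ (x≡ , _)) → x≡ }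
    }
    where
    open Walk W
    open WalkProperties W
    last-side : sideAt true len ≡ true
    last-side = sideAt-even len (even W)
    false≢true : false ≢ true
    false≢true ()

  Joined : Rel (Fin n) 0ℓ
  Joined c d = Free false c × Reach c d × Free true d

  -- Distinct strands are ordered alike at both ends: the parity of the number of vertices of
  -- the first strand to the left is constant along the second strand, and at its two ends it
  -- records the comparison of the lower and of the upper ends respectively.
  strands-increasing : ∀ {c c′ d d′} → Joined c d → Joined c′ d′ → c <ᶠ c′ → d <ᶠ d′
  strands-increasing {c} {c′} {d} {d′} (free-c , r , free-d) (free-c′ , r′ , free-d′) c<c′ =
    ind-holds (d <? d′) (begin
      parity (ind (d <? d′)) ≡⟨ sym (free-detects free-d′ (proj₁ at-d′) r free-d upper-is-d) ⟩
      leftParity d′          ≡⟨ proj₂ at-d′ ⟩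
      leftParity c′          ≡⟨ free-detects free-c′ ¬Cc′ ε free-c lower-only ⟩
      parity (ind (c <? c′)) ≡⟨ cong parity (ind-yes c<c′ (c <? c′)) ⟩
      1ℙ                     ∎)
    where
    open Strand (strand free-c)
    open Separation α reach? (λ a r → reach-step r a)
    open ≡-Reasoning
    outside : Pred (Fin n) 0ℓ
    outside x = ¬ Reach c x × leftParity x ≡ leftParity c′
    along : ∀ {s x y} → Arc s x y → outside x → outside y
    along {x = x} {y} a (¬Cx , px) = ¬Cy , trans (same-parity (<-cmp x y)) px
      where
      ¬Cy : ¬ Reach c y
      ¬Cy Cy = ¬Cx (reach-step Cy (arc-symmetric a))
      same-parity : Tri (x <ᶠ y) (x ≡ y) (y <ᶠ x) → leftParity y ≡ leftParity x
      same-parity (tri< x<y _ _)  = sym (edge-preserves a ¬Cx x<y)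
      same-parity (tri≈ _ refl _) = ⊥-elim (irreflexive arc-matching a)
      same-parity (tri> _ _ y<x)  = edge-preserves (arc-symmetric a) ¬Cy y<x
    ¬Cc′ : ¬ Reach c c′
    ¬Cc′ rc′ = <-irrefl (sym (lower-only rc′ free-c′)) c<c′
    at-d′ : outside d′
    at-d′ = star-preserves outside (λ (_ , a) → along a) r′ (¬Cc′ , refl)
    upper-is-d : ∀ {y} → Reach c y → Free true y → y ≡ d
    upper-is-d ry free-y = trans (upper-only ry free-y) (sym (upper-only r free-d))

  joined-bijection : IncreasingBijection (Free false) (Free true) Joined
  joined-bijection = record
    { domain     = proj₁
    ; codomain   = λ (_ , _ , free-d) → free-d
    ; total      = λ free-c → let open Strand (strand free-c) in end , free-c , reach-end , end-free
    ; onto       = from-upper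
    ; functional = λ (free-c , r , free-d) (_ , r′ , free-d′) →
                     let open Strand (strand free-c) in trans (upper-only r free-d) (sym (upper-only r′ free-d′))
    ; increasing = strands-increasing
    }
    where
    from-upper : ∀ {d} → Free true d → ∃ λ c → Joined c d
    from-upper free-d with walk-from false _ free-d
    ... | W , refl , refl =
      vtx len , subst (λ σ → Free σ (vtx len)) (sideAt-even len (even W)) last-free
              , reach-symmetric (reach-walk ≤-refl) , free-d
      where
      open Walk W
      open WalkProperties W

  transversal-bijection : IncreasingBijection (Free false) (Free true) (Cross false)
  transversal-bijection = record
    { domain     = λ t → _ , t
    ; codomain   = λ t → _ , cross-symmetric t
    ; total      = λ free-c → free-c
    ; onto       = λ (_ , t) → _ , cross-symmetric t
    ; functional = λ t t′ → sidePt-injective true (trans (sym t) t′)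
    ; increasing = transversals-increasing
    }

  transversal-joined : ∀ {c a} → Cross false c a → Reach c a
  transversal-joined {c} t =
    subst (Reach c) (increasing-bijections-agree joined-bijection transversal-bijection
                       ((_ , t) , reach-end , end-free) t) reach-end
    where open Strand (strand (_ , t))

module Product {n : ℕ} (α : Jones n) where
  open Local α
  open Walks α

  Glued : Rel (V3 n) 0ℓ
  Glued = GlueEdge α α

  upLink : ∀ {p q} → m α p ≡ q → Glued (embedUp p) (embedUp q)
  upLink {p} {q} eq = inj₁ (p , q , inj₂ eq , refl , refl)

  downLink : ∀ {p q} → m α p ≡ q → Glued (embedDown p) (embedDown q)
  downLink {p} {q} eq = inj₂ (p , q , inj₂ eq , refl , refl)

  glued-closed : (S : Pred (V3 n) 0ℓ) →
                 (∀ p → S (embedUp p) → S (embedUp (m α p))) →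
                 (∀ p → S (embedDown p) → S (embedDown (m α p))) →
                 ∀ {u v} → Star Glued u v → S u → S v
  glued-closed S up down = star-preserves S step
    where
    step : ∀ {u v} → Glued u v → S u → S v
    step (inj₁ (p , _ , inj₁ refl , refl , refl)) = λ s → s
    step (inj₁ (p , _ , inj₂ refl , refl , refl)) = up p
    step (inj₂ (p , _ , inj₁ refl , refl , refl)) = λ s → s
    step (inj₂ (p , _ , inj₂ refl , refl , refl)) = down p

  -- Γ(α) lives in the middle row: its lower edges come from the upper copy of α and its upper
  -- edges from the lower copy.
  middle-edge : ∀ {s x y} → Arc s x y → Glued (mid , x) (mid , y)
  middle-edge {true}  a = downLink a
  middle-edge {false} a = upLink a

  middle-path : ∀ {x y} → Reach x y → Star Glued (mid , x) (mid , y)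
  middle-path = gmap (mid ,_) (λ (_ , a) → middle-edge a)

  -- Two distinct vertices of one component that are free on the same side make αα join the
  -- other points of their two transversal blocks, which α keeps apart.
  free-pair-not-idempotent : IsIdempotent α → ∀ t {x y b b′} → Cross t x b → Cross t y b′ →
                             Reach x y → x ≢ y → ⊥
  free-pair-not-idempotent idem false {x} {y} cx cy r x≢y
    with proj₁ (idem (inj₁ _) (inj₁ _)) (upLink (cross-symmetric cx) ◅ middle-path r ◅◅ (upLink cy ◅ ε))
  ... | inj₁ b≡b′ = x≢y (sidePt-injective false (trans (sym (cross-symmetric cx))
                                                   (trans (cong (m α) b≡b′) (cross-symmetric cy))))
  ... | inj₂ to-b′ with trans (sym (cross-symmetric cx)) to-b′
  ...   | ()
  free-pair-not-idempotent idem true {x} {y} cx cy r x≢y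
    with proj₁ (idem (inj₂ _) (inj₂ _)) (downLink (cross-symmetric cx) ◅ middle-path r ◅◅ (downLink cy ◅ ε))
  ... | inj₁ b≡b′ = x≢y (sidePt-injective true (trans (sym (cross-symmetric cx))
                                                  (trans (cong (m α) b≡b′) (cross-symmetric cy))))
  ... | inj₂ to-b′ with trans (sym (cross-symmetric cx)) to-b′
  ...   | ()

  -- The ends of an alternating walk of odd length are free on the same side.
  odd-walk-not-idempotent : IsIdempotent α → (W : Walk) → parity (Walk.len W) ≡ 1ℙ → ⊥
  odd-walk-not-idempotent idem W odd =
    free-pair-not-idempotent idem (not start) (proj₂ first-free)
      (proj₂ (subst (λ σ → Free σ (vtx len)) (sideAt-odd len odd) last-free))
      (reach-walk ≤-refl) ends-distinct
    where
    open Walk W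
    open WalkProperties W
    zero-even : parity 0 ≢ 1ℙ
    zero-even ()
    ends-distinct : vtx 0 ≢ vtx len
    ends-distinct eq = zero-even (subst (λ k → parity k ≡ 1ℙ) (sym (walk-injective z≤n ≤-refl eq)) odd)

module Idempotent {n : ℕ} (α : Jones n)
                  (even : ∀ (W : Walks.Walk α) → parity (Walks.Walk.len W) ≡ 0ℙ) where
  open Local α
  open Walks α
  open EvenWalks α even
  open Product α

  rowOf : Bool → Row
  rowOf true  = top
  rowOf false = bot

  EdgeTrace : Bool → Fin n → Fin n → Pred (V3 n) 0ℓ
  EdgeTrace s i j (r , k) = r ≡ rowOf s × (k ≡ i ⊎ k ≡ j)

  edge-trace-closed : ∀ s {i j} → Arc s i j → ∀ {u v} → Star Glued u v →
                      EdgeTrace s i j u → EdgeTrace s i j v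
  edge-trace-closed s {i} {j} b = glued-closed (EdgeTrace s i j) (up s b) (down s b)
    where
    up : ∀ s → Arc s i j → ∀ p → EdgeTrace s i j (embedUp p) → EdgeTrace s i j (embedUp (m α p))
    up true  b (inj₁ k) (refl , inj₁ refl) = subst (EdgeTrace true i j ∘ embedUp) (sym b) (refl , inj₂ refl)
    up true  b (inj₁ k) (refl , inj₂ refl) =
      subst (EdgeTrace true i j ∘ embedUp) (sym (arc-symmetric b)) (refl , inj₁ refl)
    up true  b (inj₂ k) (() , _)
    up false b (inj₁ k) (() , _)
    up false b (inj₂ k) (() , _)
    down : ∀ s → Arc s i j → ∀ p → EdgeTrace s i j (embedDown p) → EdgeTrace s i j (embedDown (m α p))
    down false b (inj₂ k) (refl , inj₁ refl) = subst (EdgeTrace false i j ∘ embedDown) (sym b) (refl , inj₂ refl)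
    down false b (inj₂ k) (refl , inj₂ refl) =
      subst (EdgeTrace false i j ∘ embedDown) (sym (arc-symmetric b)) (refl , inj₁ refl)
    down false b (inj₁ k) (() , _)
    down true  b (inj₁ k) (() , _)
    down true  b (inj₂ k) (() , _)

  edge-trace-outer : ∀ s {i j} → Arc s i j → ∀ y → EdgeTrace s i j (outer y) →
                     SameBlock α (sidePt s i) y
  edge-trace-outer true  b (inj₁ k) (refl , inj₁ refl) = inj₁ refl
  edge-trace-outer true  b (inj₁ k) (refl , inj₂ refl) = inj₂ b
  edge-trace-outer true  b (inj₂ k) (() , _)
  edge-trace-outer false b (inj₁ k) (() , _)
  edge-trace-outer false b (inj₂ k) (refl , inj₁ refl) = inj₁ refl
  edge-trace-outer false b (inj₂ k) (refl , inj₂ refl) = inj₂ b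

  -- A transversal block {a, c′} of α becomes, in αα, the strand from a through the component
  -- of c in the middle row to c′.
  module Transversal {c a : Fin n} (t : Cross false c a) where
    open Strand (strand (_ , t))

    Trace : Pred (V3 n) 0ℓ
    Trace (top , i) = i ≡ a
    Trace (mid , i) = Reach c i
    Trace (bot , i) = i ≡ c

    a-is-end : a ≡ end
    a-is-end = upper-only (transversal-joined t) (_ , cross-symmetric t)

    -- The strand is closed in αα: in the middle row the component of c is left only at its
    -- free sides, i.e. from c up to a and from a down to c′.
    trace-closed : ∀ {u v} → Star Glued u v → Trace u → Trace v
    trace-closed = glued-closed Trace up down
      where
      up : ∀ p → Trace (embedUp p) → Trace (embedUp (m α p))
      up (inj₁ i) refl = subst (Trace ∘ embedUp) (sym (cross-symmetric t)) ε
      up (inj₂ i) r with partner false i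
      ... | arc b = subst (Trace ∘ embedUp) (sym b) (reach-step r b)
      ... | cross x with lower-only r (_ , x)
      ...   | refl = subst (Trace ∘ embedUp) (sym x) (sidePt-injective true (trans (sym x) t))
      down : ∀ p → Trace (embedDown p) → Trace (embedDown (m α p))
      down (inj₂ i) refl = subst (Trace ∘ embedDown) (sym t) (transversal-joined t)
      down (inj₁ i) r with partner true i
      ... | arc b = subst (Trace ∘ embedDown) (sym b) (reach-step r b)
      ... | cross x with trans (upper-only r (_ , x)) (sym a-is-end)
      ...   | refl = subst (Trace ∘ embedDown) (sym x)
                           (sidePt-injective false (trans (sym x) (cross-symmetric t)))

    trace-outer : ∀ y → Trace (outer y) → y ≡ inj₁ a ⊎ y ≡ inj₂ c
    trace-outer (inj₁ k) refl = inj₁ refl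
    trace-outer (inj₂ k) refl = inj₂ refl

    top-to-bottom : ProdBlock α α (inj₁ a) (inj₂ c)
    top-to-bottom = upLink (cross-symmetric t) ◅ middle-path (transversal-joined t)
                      ◅◅ (downLink (cross-symmetric t) ◅ ε)

    bottom-to-top : ProdBlock α α (inj₂ c) (inj₁ a)
    bottom-to-top = downLink t ◅ middle-path (reach-symmetric (transversal-joined t)) ◅◅ (upLink t ◅ ε)

  product-block⇒block : ∀ x y → ProdBlock α α x y → SameBlock α x y
  product-block⇒block (inj₁ i) y pb with partner true i
  ... | arc b = edge-trace-outer true b y (edge-trace-closed true b pb (refl , inj₁ refl))
  ... | cross x with Transversal.trace-outer (cross-symmetric x) y
                       (Transversal.trace-closed (cross-symmetric x) pb refl)
  ...   | inj₁ refl = inj₁ refl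
  ...   | inj₂ refl = inj₂ x
  product-block⇒block (inj₂ i) y pb with partner false i
  ... | arc b = edge-trace-outer false b y (edge-trace-closed false b pb (refl , inj₁ refl))
  ... | cross x with Transversal.trace-outer x y (Transversal.trace-closed x pb refl)
  ...   | inj₁ refl = inj₂ x
  ...   | inj₂ refl = inj₁ refl

  block⇒product-block : ∀ x → ProdBlock α α x (m α x)
  block⇒product-block (inj₁ i) with partner true i
  ... | arc b   = subst (ProdBlock α α (inj₁ i)) (sym b) (upLink b ◅ ε)
  ... | cross x = subst (ProdBlock α α (inj₁ i)) (sym x) (Transversal.top-to-bottom (cross-symmetric x))
  block⇒product-block (inj₂ i) with partner false i
  ... | arc b   = subst (ProdBlock α α (inj₂ i)) (sym b) (downLink b ◅ ε)
  ... | cross x = subst (ProdBlock α α (inj₂ i)) (sym x) (Transversal.bottom-to-top x)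

  idempotent : IsIdempotent α
  idempotent x y = product-block⇒block x y
                 , λ { (inj₁ refl) → ε ; (inj₂ refl) → block⇒product-block x }

corollary2p2 : (n : ℕ) → 1 ≤ n → (α : Jones n) →
    (IsIdempotent α → ¬ (∃[ L ] (Odd L × PathComponent α L)))
    × (¬ (∃[ L ] (Odd L × PathComponent α L)) → IsIdempotent α)
corollary2p2 n _ α =
    (λ idem (L , odd , P) → let (W , odd-W) = Walks.odd-component-walk α odd P in
                            Product.odd-walk-not-idempotent α idem W odd-W)
  , (λ no-odd → Idempotent.idempotent α (Walks.walks-even α no-odd))
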